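{- For $n\ge 0$ let $r_n(q)=\sum_{a=0}^{n}\sum_{P\in\mathcal Y^E_{a,n-a}}q^{\mathrm{area}(P)}$. Then for $n\geq 2$, $$r_n(q)=(1+q)r_{n-1}(q)+(q^n-q)r_{n-2}(q).$$
   Context: For integers $a,b\ge0$, $\mathcal Y^E_{a,b}$ is the set of lattice paths with unit steps $N=(0,1)$ and $E=(1,0)$ from $(0,0)$ to $(b+1,a)$ whose first step is $E$. For such a path $P$, $\mathrm{area}(P)$ is the number of unit squares of the rectangle $[0,b+1]\times[0,a]$ lying above/left of $P$, i.e. the size of the Young diagram (justified to the top-left corner of the rectangle) whose southeast boundary is $P$. -}

module Defs where

open import Data.Nat using (ℕ; zero; suc; _∸_) renaming (_+_ to _+ℕ_)
open import Data.List using (List; []; _∷_; map; _++_)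
open import Algebra.Bundles using (CommutativeRing)
open import Level using (Level)

-- unit steps N = (0,1), E = (1,0)
data Step : Set where
  N E : Step

paths : ℕ → ℕ → List (List Step)
paths zero    zero    = [] ∷ []
paths (suc a) zero    = map (N ∷_) (paths a zero)
paths zero    (suc b) = map (E ∷_) (paths zero b)
paths (suc a) (suc b) = map (N ∷_) (paths a (suc b)) ++ map (E ∷_) (paths (suc a) b)

-- 𝒴^E_{a,b}: paths from (0,0) to (b+1,a) whose first step is E
-- (= E followed by any path with a N-steps and b E-steps)
YE : ℕ → ℕ → List (List Step)
YE a b = map (E ∷_) (paths a b)

countN : List Step → ℕ
countN []      = 0
countN (N ∷ p) = suc (countN p)
countN (E ∷ p) = countN p

-- area(P): number of unit squares of the rectangle lying above/left of P.
-- An E step taken at height h contributes the column of (a - h) squares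
-- above it, and a - h is the number of N steps still to come.
area : List Step → ℕ
area []      = 0
area (N ∷ p) = area p
area (E ∷ p) = countN p +ℕ area p

-- r_n(q) evaluated in an arbitrary commutative ring (a polynomial identity
-- with integer coefficients holds iff it holds in every commutative ring)
module Poly {c ℓ : Level} (R : CommutativeRing c ℓ) where
  open CommutativeRing R

  pow : Carrier → ℕ → Carrier
  pow x zero    = 1#
  pow x (suc k) = x * pow x k

  sumR : List Carrier → Carrier
  sumR []       = 0#
  sumR (x ∷ xs) = x + sumR xs

  genY : Carrier → ℕ → ℕ → Carrier
  genY q a b = sumR (map (λ P → pow q (area P)) (YE a b))

  sumA : Carrier → ℕ → ℕ → Carrier
  sumA q n zero    = genY q 0 (n ∸ 0)
  sumA q n (suc k) = sumA q n k + genY q (suc k) (n ∸ suc k)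

  r : Carrier → ℕ → Carrier
  r q n = sumA q n n

-- Splitting a path at its first step shows that Σ_{P} q^{area P} over paths with a N-steps
-- and b E-steps is the Gaussian binomial [a+b, a]_q, and the leading E of a path in 𝒴^E_{a,b}
-- adds a column of height a; hence r_n = Σ_a q^a [n, a]_q.  For the Galois numbers
-- G_n = Σ_a [n, a]_q the two q-Pascal rules give G_{n+1} = G_n + r_n and
-- r_{n+1} = r_n + q^{n+1} G_n, and eliminating G yields the recurrence.
module Submission where

open import Defs
open import Data.Nat using (ℕ; _≤_; _∸_; zero; suc; s≤s) renaming (_+_ to _+ℕ_)
open import Data.Nat.Properties using (+-suc)
open import Data.List using (List; []; _∷_; map; _++_)
open import Data.List.Properties using (map-++; map-∘)
open import Data.List.Relation.Unary.All as All using (All; []; _∷_)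
open import Data.List.Relation.Unary.All.Properties using (map⁺; ++⁺)
open import Algebra.Bundles using (CommutativeRing)
open import Level using (Level)
open import Relation.Binary.PropositionalEquality as ≡ using (_≡_)
import Algebra.Solver.Ring.NaturalCoefficients.Default as NatSolver
import Relation.Binary.Reasoning.Setoid as SetoidReasoning

countN-paths : ∀ a b → All (λ P → countN P ≡ a) (paths a b)
countN-paths zero    zero    = ≡.refl ∷ []
countN-paths (suc a) zero    = map⁺ (All.map (≡.cong suc) (countN-paths a zero))
countN-paths zero    (suc b) = map⁺ (countN-paths zero b)
countN-paths (suc a) (suc b) =
  ++⁺ (map⁺ (All.map (≡.cong suc) (countN-paths a (suc b)))) (map⁺ (countN-paths (suc a) b))

module _ {c ℓ : Level} (R : CommutativeRing c ℓ) where
  open CommutativeRing R hiding (zero)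
  open Poly R
  open SetoidReasoning setoid
  open NatSolver commutativeSemiring using (solve; _:=_; _:+_; _:*_; con)

  pow-distribˡ-+-* : ∀ x m n → pow x (m +ℕ n) ≈ pow x m * pow x n
  pow-distribˡ-+-* x zero    n = sym (*-identityˡ _)
  pow-distribˡ-+-* x (suc m) n = trans (*-congˡ (pow-distribˡ-+-* x m n)) (sym (*-assoc _ _ _))

  sumR-++ : ∀ xs ys → sumR (xs ++ ys) ≈ sumR xs + sumR ys
  sumR-++ []       ys = sym (+-identityˡ _)
  sumR-++ (x ∷ xs) ys = trans (+-congˡ (sumR-++ xs ys)) (sym (+-assoc _ _ _))

  x+qy≈z+py⇒x≈z+[p-q]y : ∀ {x y z p q} → x + q * y ≈ z + p * y → x ≈ z + (p - q) * y
  x+qy≈z+py⇒x≈z+[p-q]y {x} {y} {z} {p} {q} eq = begin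
    x                        ≈⟨ sym (+-identityʳ x) ⟩
    x + 0#                   ≈⟨ +-congˡ (sym (trans (*-congʳ (-‿inverseʳ q)) (zeroˡ y))) ⟩
    x + (q - q) * y          ≈⟨ solve 4 (λ x y q w → x :+ (q :+ w) :* y := (x :+ q :* y) :+ w :* y)
                                      refl x y q (- q) ⟩
    (x + q * y) + - q * y    ≈⟨ +-congʳ eq ⟩
    (z + p * y) + - q * y    ≈⟨ solve 4 (λ z p y w → (z :+ p :* y) :+ w :* y := z :+ (p :+ w) :* y)
                                      refl z p y (- q) ⟩
    z + (p - q) * y          ∎

  antidiagonalSum : (ℕ → ℕ → Carrier) → ℕ → Carrier
  antidiagonalSum f zero    = f 0 0
  antidiagonalSum f (suc n) = f 0 (suc n) + antidiagonalSum (λ a b → f (suc a) b) n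

  antidiagonalSum-cong : ∀ n {f h : ℕ → ℕ → Carrier} →
                         (∀ a b → a +ℕ b ≡ n → f a b ≈ h a b) →
                         antidiagonalSum f n ≈ antidiagonalSum h n
  antidiagonalSum-cong zero    eq = eq 0 0 ≡.refl
  antidiagonalSum-cong (suc n) eq =
    +-cong (eq 0 (suc n) ≡.refl) (antidiagonalSum-cong n (λ a b e → eq (suc a) b (≡.cong suc e)))

  antidiagonalSum-+ : ∀ n (f h : ℕ → ℕ → Carrier) →
                      antidiagonalSum (λ a b → f a b + h a b) n ≈
                      antidiagonalSum f n + antidiagonalSum h n
  antidiagonalSum-+ zero    f h = refl
  antidiagonalSum-+ (suc n) f h =
    trans (+-congˡ (antidiagonalSum-+ n (λ a b → f (suc a) b) (λ a b → h (suc a) b)))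
          (solve 4 (λ x y z w → (x :+ y) :+ (z :+ w) := (x :+ z) :+ (y :+ w)) refl _ _ _ _)

  antidiagonalSum-*ˡ : ∀ n x (f : ℕ → ℕ → Carrier) →
                       antidiagonalSum (λ a b → x * f a b) n ≈ x * antidiagonalSum f n
  antidiagonalSum-*ˡ zero    x f = refl
  antidiagonalSum-*ˡ (suc n) x f =
    trans (+-congˡ (antidiagonalSum-*ˡ n x (λ a b → f (suc a) b))) (sym (distribˡ _ _ _))

  antidiagonalSum-suc : ∀ n (f : ℕ → ℕ → Carrier) →
                        antidiagonalSum f (suc n) ≈
                        antidiagonalSum (λ a b → f a (suc b)) n + f (suc n) 0
  antidiagonalSum-suc zero    f = refl
  antidiagonalSum-suc (suc n) f =
    trans (+-congˡ (antidiagonalSum-suc n (λ a b → f (suc a) b))) (sym (+-assoc _ _ _))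

  antidiagonalPrefix : (ℕ → ℕ → Carrier) → ℕ → ℕ → Carrier
  antidiagonalPrefix f n zero    = f 0 n
  antidiagonalPrefix f n (suc k) = antidiagonalPrefix f n k + f (suc k) (n ∸ suc k)

  antidiagonalPrefix-suc : ∀ f n k → antidiagonalPrefix f (suc n) (suc k) ≈
                                     f 0 (suc n) + antidiagonalPrefix (λ a b → f (suc a) b) n k
  antidiagonalPrefix-suc f n zero    = refl
  antidiagonalPrefix-suc f n (suc k) =
    trans (+-congʳ (antidiagonalPrefix-suc f n k)) (+-assoc _ _ _)

  antidiagonalPrefix≈antidiagonalSum : ∀ f n → antidiagonalPrefix f n n ≈ antidiagonalSum f n
  antidiagonalPrefix≈antidiagonalSum f zero    = refl
  antidiagonalPrefix≈antidiagonalSum f (suc n) =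
    trans (antidiagonalPrefix-suc f n n)
          (+-congˡ (antidiagonalPrefix≈antidiagonalSum (λ a b → f (suc a) b) n))

  sumA≡antidiagonalPrefix : ∀ q n k → sumA q n k ≡ antidiagonalPrefix (genY q) n k
  sumA≡antidiagonalPrefix q n zero    = ≡.refl
  sumA≡antidiagonalPrefix q n (suc k) =
    ≡.cong (_+ genY q (suc k) (n ∸ suc k)) (sumA≡antidiagonalPrefix q n k)

  r≈antidiagonalSum : ∀ q n → r q n ≈ antidiagonalSum (genY q) n
  r≈antidiagonalSum q n =
    trans (reflexive (sumA≡antidiagonalPrefix q n n)) (antidiagonalPrefix≈antidiagonalSum (genY q) n)

  module _ (q : Carrier) where

    -- qBinomial a b is the Gaussian binomial [a + b, a]_q.
    qBinomial : ℕ → ℕ → Carrier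
    qBinomial zero    b       = 1#
    qBinomial (suc a) zero    = 1#
    qBinomial (suc a) (suc b) = qBinomial a (suc b) + pow q (suc a) * qBinomial (suc a) b

    qBinomial-zeroʳ : ∀ a → qBinomial a 0 ≡ 1#
    qBinomial-zeroʳ zero    = ≡.refl
    qBinomial-zeroʳ (suc a) = ≡.refl

    qBinomial-pascal : ∀ a b → qBinomial (suc a) (suc b) ≈
                               qBinomial (suc a) b + pow q (suc b) * qBinomial a (suc b)
    qBinomial-pascal zero    zero    = refl
    qBinomial-pascal zero    (suc b) =
      trans (+-congˡ (*-congˡ (qBinomial-pascal zero b)))
            (solve 3 (λ q Qb G → con 1 :+ (q :* con 1) :* (G :+ Qb :* con 1)
                              := (con 1 :+ (q :* con 1) :* G) :+ (q :* Qb) :* con 1)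
                   refl q (pow q (suc b)) (qBinomial 1 b))
    qBinomial-pascal (suc a) zero    =
      trans (+-congʳ (qBinomial-pascal a zero))
            (solve 3 (λ q Qa G → (con 1 :+ (q :* con 1) :* G) :+ (q :* Qa) :* con 1
                              := con 1 :+ (q :* con 1) :* (G :+ Qa :* con 1))
                   refl q (pow q (suc a)) (qBinomial a 1))
    qBinomial-pascal (suc a) (suc b) =
      trans (+-cong (qBinomial-pascal a (suc b)) (*-congˡ (qBinomial-pascal (suc a) b)))
            (solve 6 (λ q Qa Qb X Y Z →
                        (X :+ (q :* Qb) :* Y) :+ (q :* Qa) :* (Z :+ Qb :* X)
                     := (X :+ (q :* Qa) :* Z) :+ (q :* Qb) :* (Y :+ Qa :* X))
                   refl q (pow q (suc a)) (pow q (suc b))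
                   (qBinomial (suc a) (suc b)) (qBinomial a (suc (suc b))) (qBinomial (suc (suc a)) b))

    areaWeight : List Step → Carrier
    areaWeight P = pow q (area P)

    areaSum : List (List Step) → Carrier
    areaSum Ps = sumR (map areaWeight Ps)

    areaSum-++ : ∀ Ps Qs → areaSum (Ps ++ Qs) ≈ areaSum Ps + areaSum Qs
    areaSum-++ Ps Qs =
      trans (reflexive (≡.cong sumR (map-++ areaWeight Ps Qs)))
            (sumR-++ (map areaWeight Ps) (map areaWeight Qs))

    areaSum-N∷ : ∀ Ps → areaSum (map (N ∷_) Ps) ≡ areaSum Ps
    areaSum-N∷ Ps = ≡.cong sumR (≡.sym (map-∘ Ps))

    areaSum-E∷ : ∀ {k Ps} → All (λ P → countN P ≡ k) Ps →
                 areaSum (map (E ∷_) Ps) ≈ pow q k * areaSum Ps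
    areaSum-E∷ []                    = sym (zeroʳ _)
    areaSum-E∷ {k} {P ∷ _} (≡.refl ∷ Ps) =
      trans (+-cong (pow-distribˡ-+-* q k (area P)) (areaSum-E∷ Ps)) (sym (distribˡ _ _ _))

    areaSum-paths : ∀ a b → areaSum (paths a b) ≈ qBinomial a b
    areaSum-paths zero    zero    = +-identityʳ 1#
    areaSum-paths (suc a) zero    =
      trans (reflexive (areaSum-N∷ (paths a zero)))
            (trans (areaSum-paths a zero) (reflexive (qBinomial-zeroʳ a)))
    areaSum-paths zero    (suc b) =
      trans (areaSum-E∷ (countN-paths zero b)) (trans (*-identityˡ _) (areaSum-paths zero b))
    areaSum-paths (suc a) (suc b) = begin
      areaSum (map (N ∷_) (paths a (suc b)) ++ map (E ∷_) (paths (suc a) b))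
        ≈⟨ areaSum-++ (map (N ∷_) (paths a (suc b))) (map (E ∷_) (paths (suc a) b)) ⟩
      areaSum (map (N ∷_) (paths a (suc b))) + areaSum (map (E ∷_) (paths (suc a) b))
        ≈⟨ +-cong (reflexive (areaSum-N∷ (paths a (suc b)))) (areaSum-E∷ (countN-paths (suc a) b)) ⟩
      areaSum (paths a (suc b)) + pow q (suc a) * areaSum (paths (suc a) b)
        ≈⟨ +-cong (areaSum-paths a (suc b)) (*-congˡ (areaSum-paths (suc a) b)) ⟩
      qBinomial (suc a) (suc b) ∎

    weightedQBinomial : ℕ → ℕ → Carrier
    weightedQBinomial a b = pow q a * qBinomial a b

    genY≈weightedQBinomial : ∀ a b → genY q a b ≈ weightedQBinomial a b
    genY≈weightedQBinomial a b = trans (areaSum-E∷ (countN-paths a b)) (*-congˡ (areaSum-paths a b))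

    galois : ℕ → Carrier
    galois = antidiagonalSum qBinomial

    weightedGalois : ℕ → Carrier
    weightedGalois = antidiagonalSum weightedQBinomial

    galois-suc : ∀ n → galois (suc n) ≈ galois n + weightedGalois n
    galois-suc zero    = +-congˡ (sym (*-identityˡ 1#))
    galois-suc (suc m) = begin
      1# + antidiagonalSum (λ a b → qBinomial (suc a) b) (suc m)
        ≈⟨ +-congˡ (antidiagonalSum-suc m (λ a b → qBinomial (suc a) b)) ⟩
      1# + (antidiagonalSum (λ a b → qBinomial (suc a) (suc b)) m + 1#)
        ≈⟨ +-congˡ (+-congʳ (antidiagonalSum-+ m (λ a b → qBinomial a (suc b)) shifted)) ⟩
      1# + ((X + Y) + 1#)
        ≈⟨ solve 2 (λ X Y → con 1 :+ ((X :+ Y) :+ con 1) := (X :+ con 1) :+ (con 1 :* con 1 :+ Y))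
                 refl X Y ⟩
      (X + 1#) + (1# * 1# + Y)
        ≈⟨ +-congʳ (sym (antidiagonalSum-suc m qBinomial)) ⟩
      galois (suc m) + weightedGalois (suc m) ∎
      where
      shifted : ℕ → ℕ → Carrier
      shifted a = weightedQBinomial (suc a)
      X Y : Carrier
      X = antidiagonalSum (λ a b → qBinomial a (suc b)) m
      Y = antidiagonalSum shifted m

    weightedGalois-suc : ∀ n → weightedGalois (suc n) ≈ weightedGalois n + pow q (suc n) * galois n
    weightedGalois-suc zero    = refl
    weightedGalois-suc (suc m) = begin
      1# * 1# + antidiagonalSum shifted (suc m)
        ≈⟨ +-congˡ (antidiagonalSum-suc m shifted) ⟩
      1# * 1# + (antidiagonalSum (λ a b → shifted a (suc b)) m + Q * 1#)
        ≈⟨ +-congˡ (+-congʳ shifted-pascal) ⟩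
      1# * 1# + ((Y + Q * X) + Q * 1#)
        ≈⟨ solve 3 (λ X Y Q → con 1 :* con 1 :+ ((Y :+ Q :* X) :+ Q :* con 1)
                            := (con 1 :* con 1 :+ Y) :+ Q :* (X :+ con 1)) refl X Y Q ⟩
      (1# * 1# + Y) + Q * (X + 1#)
        ≈⟨ +-congˡ (*-congˡ (sym (antidiagonalSum-suc m qBinomial))) ⟩
      weightedGalois (suc m) + Q * galois (suc m) ∎
      where
      shifted : ℕ → ℕ → Carrier
      shifted a = weightedQBinomial (suc a)
      X Y : Carrier
      X = antidiagonalSum (λ a b → qBinomial a (suc b)) m
      Y = antidiagonalSum shifted m
      Q : Carrier
      Q = pow q (suc (suc m))

      shifted-suc : ∀ a b → a +ℕ b ≡ m → shifted a (suc b) ≈ shifted a b + Q * qBinomial a (suc b)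
      shifted-suc a b a+b≡m = begin
        pow q (suc a) * qBinomial (suc a) (suc b)
          ≈⟨ trans (*-congˡ (qBinomial-pascal a b)) (distribˡ _ _ _) ⟩
        shifted a b + pow q (suc a) * (pow q (suc b) * qBinomial a (suc b))
          ≈⟨ +-congˡ (sym (*-assoc _ _ _)) ⟩
        shifted a b + pow q (suc a) * pow q (suc b) * qBinomial a (suc b)
          ≈⟨ +-congˡ (*-congʳ (sym (pow-distribˡ-+-* q (suc a) (suc b)))) ⟩
        shifted a b + pow q (suc a +ℕ suc b) * qBinomial a (suc b)
          ≡⟨ ≡.cong (λ k → shifted a b + pow q (suc k) * qBinomial a (suc b))
                    (≡.trans (+-suc a b) (≡.cong suc a+b≡m)) ⟩
        shifted a b + Q * qBinomial a (suc b) ∎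

      shifted-pascal : antidiagonalSum (λ a b → shifted a (suc b)) m ≈ Y + Q * X
      shifted-pascal =
        trans (antidiagonalSum-cong m shifted-suc)
              (trans (antidiagonalSum-+ m shifted (λ a b → Q * qBinomial a (suc b)))
                     (+-congˡ (antidiagonalSum-*ˡ m Q (λ a b → qBinomial a (suc b)))))

    r≈weightedGalois : ∀ n → r q n ≈ weightedGalois n
    r≈weightedGalois n =
      trans (r≈antidiagonalSum q n) (antidiagonalSum-cong n (λ a b _ → genY≈weightedQBinomial a b))

    weightedGalois-recurrence : ∀ m →
      weightedGalois (suc (suc m)) + q * weightedGalois m ≈
      (1# + q) * weightedGalois (suc m) + pow q (suc (suc m)) * weightedGalois m
    weightedGalois-recurrence m = begin
      W₂ + q * W₀
        ≈⟨ +-congʳ (trans (weightedGalois-suc (suc m)) (+-congˡ (*-congˡ (galois-suc m)))) ⟩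
      (W₁ + q * Pw * (G + W₀)) + q * W₀
        ≈⟨ solve 5 (λ q Pw G W₀ W₁ → (W₁ :+ q :* Pw :* (G :+ W₀)) :+ q :* W₀
                                  := (W₁ :+ q :* (W₀ :+ Pw :* G)) :+ q :* Pw :* W₀)
                 refl q Pw G W₀ W₁ ⟩
      (W₁ + q * (W₀ + Pw * G)) + q * Pw * W₀
        ≈⟨ +-congʳ (+-congˡ (*-congˡ (sym (weightedGalois-suc m)))) ⟩
      (W₁ + q * W₁) + q * Pw * W₀
        ≈⟨ +-congʳ (sym (trans (distribʳ W₁ 1# q) (+-congʳ (*-identityˡ W₁)))) ⟩
      (1# + q) * W₁ + q * Pw * W₀ ∎
      where
      W₀ W₁ W₂ G Pw : Carrier
      W₀ = weightedGalois m
      W₁ = weightedGalois (suc m)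
      W₂ = weightedGalois (suc (suc m))
      G  = galois m
      Pw = pow q (suc m)

    r-recurrence : ∀ m → r q (suc (suc m)) ≈ (1# + q) * r q (suc m) + (pow q (suc (suc m)) - q) * r q m
    r-recurrence m = x+qy≈z+py⇒x≈z+[p-q]y (begin
      r q (suc (suc m)) + q * r q m
        ≈⟨ +-cong (r≈weightedGalois (suc (suc m))) (*-congˡ (r≈weightedGalois m)) ⟩
      weightedGalois (suc (suc m)) + q * weightedGalois m
        ≈⟨ weightedGalois-recurrence m ⟩
      (1# + q) * weightedGalois (suc m) + pow q (suc (suc m)) * weightedGalois m
        ≈⟨ sym (+-cong (*-congˡ (r≈weightedGalois (suc m))) (*-congˡ (r≈weightedGalois m))) ⟩
      (1# + q) * r q (suc m) + pow q (suc (suc m)) * r q m ∎)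

proposition3p8 : ∀ {c ℓ : Level} (R : CommutativeRing c ℓ) (q : CommutativeRing.Carrier R) (n : ℕ) → 2 ≤ n →
    let open CommutativeRing R
        open Poly R
    in r q n ≈ (1# + q) * r q (n ∸ 1) + (pow q n - q) * r q (n ∸ 2)
proposition3p8 R q (suc (suc m)) (s≤s (s≤s _)) = r-recurrence R q m
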